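{- For any DAG $G=(V,E)$ and any $c\geq 2$, the weighting functions $$\rho(v)=(c|V|)^{\mathrm{depth}(G)-\mathrm{level}(v)},\qquad \omega(v)=(c+1)^{|\mathrm{Desc}(v)|}$$ are $c$-admissible.
   Context: A weighting function on a DAG $G=(V,E)$ is an efficiently computable $f:V\to\mathbb{R}$; it is $c$-admissible if for all $v\in V$, $f(v)\geq 1+c\sum_{w\in\Gamma(v)}f(w)$, where $\Gamma(v)=\{w:(v,w)\in E\}$ is the set of out-neighbours of $v$. $\mathrm{Desc}(v)$ is the set of nodes reachable from $v$ by a directed path, excluding $v$. Levels: level $0$ consists of nodes with no incoming edges; a node is at level $i+1$ if all its in-neighbours $w$ have $\mathrm{level}(w)\le i$ and at least one has level $i$; $\mathrm{depth}(G)$ is the maximum level.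
   Formalization: The constant c ranges over the rationals rather than the reals, so the weighting functions ρ and ω take rational values. -}

module Defs where

open import Data.Nat as ℕ using (ℕ; zero; suc; _∸_)
open import Data.Integer using (+_)
open import Data.Rational as ℚ using (ℚ; 0ℚ; 1ℚ; _+_; _*_; _≥_)
open import Data.Fin using (Fin)
open import Data.List using (List; filter; length; foldr; map)
open import Data.List.Base using (allFin)
open import Data.Bool using (Bool; T)
open import Data.Product using (Σ; _×_)
open import Relation.Nullary using (¬_; Dec)
open import Relation.Binary.PropositionalEquality using (_≡_)
open import Relation.Binary.Construct.Closure.Transitive using (TransClosure)
open import Relation.Unary using (Decidable)
open import Data.Bool.Properties using (T?)

Graph : ℕ → Set
Graph n = Fin n → Fin n → Bool

Edge : ∀ {n} → Graph n → Fin n → Fin n → Set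
Edge E v w = T (E v w)

Reach : ∀ {n} → Graph n → Fin n → Fin n → Set
Reach E = TransClosure (Edge E)

IsDAG : ∀ {n} → Graph n → Set
IsDAG {n} E = (v : Fin n) → ¬ Reach E v v

ℕ→ℚ : ℕ → ℚ
ℕ→ℚ k = + k ℚ./ 1

_^ℚ_ : ℚ → ℕ → ℚ
q ^ℚ zero = 1ℚ
q ^ℚ suc k = q * (q ^ℚ k)

sumℚ : List ℚ → ℚ
sumℚ = foldr _+_ 0ℚ

Γ : ∀ {n} → Graph n → Fin n → List (Fin n)
Γ E v = filter (λ w → T? (E v w)) (allFin _)

Admissible : ∀ {n} → Graph n → ℚ → (Fin n → ℚ) → Set
Admissible {n} E c f =
  (v : Fin n) → f v ≥ 1ℚ + c * sumℚ (map f (Γ E v))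

-- |Desc(v)|, computed from any decision procedure for reachability
-- (the count does not depend on which decider is used).
descCount : ∀ {n} (E : Graph n) → ((v w : Fin n) → Dec (Reach E v w)) →
            Fin n → ℕ
descCount E reach? v = length (filter (reach? v) (allFin _))

IsLevel : ∀ {n} → Graph n → (Fin n → ℕ) → Set
IsLevel {n} E lvl = (v : Fin n) →
    (((w : Fin n) → ¬ Edge E w v) → lvl v ≡ 0)
  × (Σ (Fin n) (λ w → Edge E w v) →
       Σ ℕ λ i → (lvl v ≡ suc i)
               × ((w : Fin n) → Edge E w v → lvl w ℕ.≤ i)
               × Σ (Fin n) (λ w → Edge E w v × (lvl w ≡ i)))

IsDepth : ∀ {n} → (Fin n → ℕ) → ℕ → Set
IsDepth {n} lvl d = ((v : Fin n) → lvl v ℕ.≤ d) × Σ (Fin n) (λ v → lvl v ≡ d)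

ρ : ∀ {n} → ℚ → (Fin n → ℕ) → ℕ → Fin n → ℚ
ρ {n} c lvl d v = (c * ℕ→ℚ n) ^ℚ (d ∸ lvl v)

ω : ∀ {n} (E : Graph n) → ((v w : Fin n) → Dec (Reach E v w)) → ℚ →
    Fin n → ℚ
ω E reach? c v = (c + 1ℚ) ^ℚ descCount E reach? v

{-# OPTIONS --safe #-}
-- Along an edge v → w the level strictly increases, so with y = c|V| and ρ(v) = y^k every
-- out-neighbour has ρ(w) ≤ y^(k-1); as v has at most |V| - 1 out-neighbours,
-- 1 + c Σ ρ(w) ≤ c y^(k-1) + c (|V| - 1) y^(k-1) = ρ(v).
-- For ω let x = c + 1 and let ↑S be S together with everything reachable from S. Induction on
-- S gives 1 + c Σ_{w ∈ S} x^|Desc w| ≤ x^|↑S|: the element m of S with the most descendants is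
-- reachable from no other element of S, so |Desc m| and |↑(S - m)| are both below |↑S|, and
-- 1 + c (x^a + s) ≤ x^M whenever a, b < M and 1 + c s ≤ x^b. For S = Γ(v), ↑S ⊆ Desc(v).
module Submission where

open import Defs
open import Data.Nat using (ℕ)
open import Data.Fin using (Fin)
open import Data.Rational using (ℚ; _≥_; 1ℚ; _+_)
open import Data.Product using (_×_)
open import Relation.Nullary using (Dec)

open import Algebra.Bundles using (CommutativeMonoid)
open import Data.Bool.Properties using (T?)
import Data.Fin as Fin
import Data.Integer as ℤ
import Data.Integer.Properties as ℤ using (*-identityʳ)
open import Data.List using (List; []; _∷_; length; map; filter; allFin)
open import Data.List.Extrema.Nat using (argmax; argmax-all; f[⊥]≤f[argmax]; f[xs]≤f[argmax])
open import Data.List.Membership.Propositional using (_∈_; _∉_; find; lose)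
open import Data.List.Membership.Propositional.Properties using (∈-filter⁺; ∈-filter⁻; ∈-allFin)
open import Data.List.Properties using (filter-notAll; length-tabulate; length-removeAt′)
open import Data.List.Relation.Binary.Pointwise using (Pointwise-≡⇒≡)
import Data.List.Relation.Binary.Sublist.Propositional as Sublist
open import Data.List.Relation.Binary.Sublist.Propositional.Properties
  using (length-mono-≤; to-≋) renaming (filter⁺ to filter-sublist⁺)
open import Data.List.Relation.Unary.All as All using (All; []; _∷_)
open import Data.List.Relation.Unary.All.Properties using (─⁺)
open import Data.List.Relation.Unary.AllPairs using ([]; _∷_)
open import Data.List.Relation.Unary.Any as Any using (Any; here; there; _─_)
open import Data.List.Relation.Unary.Unique.Propositional using (Unique)
open import Data.List.Relation.Unary.Unique.Propositional.Properties
  using (allFin⁺) renaming (filter⁺ to Unique-filter⁺)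
open import Data.Nat as ℕ using (zero; suc; _∸_; z≤n; s≤s; s≤s⁻¹)
import Data.Nat.Properties as ℕ
open import Data.Nat.Coprimality using (Coprime; 1-coprimeTo) renaming (sym to coprime-sym)
open import Data.Product using (Σ; _,_; proj₂)
open import Data.Rational using (0ℚ; _*_; _≤_; _/_; mkℚ; nonNegative)
open import Data.Rational.Properties
  using ( ≤-refl; ≤-trans; ≤-reflexive; +-mono-≤; +-monoʳ-≤; +-monoˡ-≤
        ; *-monoˡ-≤-nonNeg; *-monoʳ-≤-nonNeg; *-zeroˡ; *-zeroʳ; *-identityˡ
        ; +-identityʳ; *-distribˡ-+; *-distribʳ-+; *-assoc; +-0-commutativeMonoid
        ; ↥p/↧p≡p; nonNegative⁻¹; normalize-nonNeg; module ≤-Reasoning)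
open import Algebra.Properties.CommutativeSemigroup
  (CommutativeMonoid.commutativeSemigroup +-0-commutativeMonoid) using (x∙yz≈y∙xz)
open import Data.Sum using (_⊎_; inj₁; inj₂)
open import Level using (0ℓ)
open import Relation.Binary using (Rel; Transitive)
import Relation.Binary.Definitions as B
open import Relation.Binary.Construct.Closure.Transitive using ([_]; _∷_; _++_)
open import Relation.Binary.PropositionalEquality
  using (_≡_; _≢_; refl; sym; trans; cong; subst; module ≡-Reasoning)
open import Relation.Nullary using (¬_)
open import Relation.Nullary.Decidable using (_⊎-dec_)
open import Relation.Unary using (Pred; Decidable; _⊆_)

0≤1 : 0ℚ ≤ 1ℚ
0≤1 = nonNegative⁻¹ 1ℚ

1≤2 : 1ℚ ≤ 1ℚ + 1ℚ
1≤2 = +-monoʳ-≤ 1ℚ 0≤1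

*-monoˡ-≤-0≤ : ∀ {r p q} → 0ℚ ≤ r → p ≤ q → r * p ≤ r * q
*-monoˡ-≤-0≤ {r} 0≤r = *-monoˡ-≤-nonNeg r {{nonNegative 0≤r}}

*-monoʳ-≤-0≤ : ∀ {r p q} → 0ℚ ≤ r → p ≤ q → p * r ≤ q * r
*-monoʳ-≤-0≤ {r} 0≤r = *-monoʳ-≤-nonNeg r {{nonNegative 0≤r}}

1≤* : ∀ {p q} → 1ℚ ≤ p → 1ℚ ≤ q → 1ℚ ≤ p * q
1≤* {p} {q} 1≤p 1≤q = begin
  1ℚ       ≡⟨ *-identityˡ 1ℚ ⟨
  1ℚ * 1ℚ  ≤⟨ *-monoʳ-≤-0≤ 0≤1 1≤p ⟩
  p * 1ℚ   ≤⟨ *-monoˡ-≤-0≤ (≤-trans 0≤1 1≤p) 1≤q ⟩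
  p * q    ∎
  where open ≤-Reasoning

1+*0≡1 : ∀ c → 1ℚ + c * 0ℚ ≡ 1ℚ
1+*0≡1 c = trans (cong (1ℚ +_) (*-zeroʳ c)) (+-identityʳ 1ℚ)

ℕ→ℚ-suc : ∀ k → ℕ→ℚ (suc k) ≡ 1ℚ + ℕ→ℚ k
ℕ→ℚ-suc k = begin
  ℤ.+ suc k / 1
    ≡⟨ cong (λ i → (ℤ.+ 1 ℤ.+ i) / 1) (ℤ.*-identityʳ (ℤ.+ k)) ⟨
  1ℚ + mkℚ (ℤ.+ k) 0 ℕ→ℚ-coprime
    ≡⟨ cong (1ℚ +_) (↥p/↧p≡p (mkℚ (ℤ.+ k) 0 ℕ→ℚ-coprime)) ⟨
  1ℚ + ℕ→ℚ k
    ∎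
  where
  open ≡-Reasoning
  ℕ→ℚ-coprime : Coprime k 1
  ℕ→ℚ-coprime = coprime-sym (1-coprimeTo k)

ℕ→ℚ-suc-* : ∀ k b → ℕ→ℚ (suc k) * b ≡ b + ℕ→ℚ k * b
ℕ→ℚ-suc-* k b = begin
  ℕ→ℚ (suc k) * b          ≡⟨ cong (_* b) (ℕ→ℚ-suc k) ⟩
  (1ℚ + ℕ→ℚ k) * b         ≡⟨ *-distribʳ-+ b 1ℚ (ℕ→ℚ k) ⟩
  1ℚ * b + ℕ→ℚ k * b       ≡⟨ cong (_+ ℕ→ℚ k * b) (*-identityˡ b) ⟩
  b + ℕ→ℚ k * b            ∎
  where open ≡-Reasoning

ℕ→ℚ-nonNeg : ∀ k → 0ℚ ≤ ℕ→ℚ k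
ℕ→ℚ-nonNeg k = nonNegative⁻¹ (ℕ→ℚ k) {{normalize-nonNeg k 1}}

ℕ→ℚ-mono-≤ : ∀ {m n} → m ℕ.≤ n → ℕ→ℚ m ≤ ℕ→ℚ n
ℕ→ℚ-mono-≤ {n = n} z≤n = ℕ→ℚ-nonNeg n
ℕ→ℚ-mono-≤ {suc m} {suc n} (s≤s m≤n) rewrite ℕ→ℚ-suc m | ℕ→ℚ-suc n =
  +-monoʳ-≤ 1ℚ (ℕ→ℚ-mono-≤ m≤n)

1≤^ℚ : ∀ {q} k → 1ℚ ≤ q → 1ℚ ≤ q ^ℚ k
1≤^ℚ zero    _   = ≤-refl
1≤^ℚ (suc k) 1≤q = 1≤* 1≤q (1≤^ℚ k 1≤q)

^ℚ-monoʳ-≤ : ∀ {q m n} → 1ℚ ≤ q → m ℕ.≤ n → q ^ℚ m ≤ q ^ℚ n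
^ℚ-monoʳ-≤ {n = n} 1≤q z≤n = 1≤^ℚ n 1≤q
^ℚ-monoʳ-≤ 1≤q (s≤s m≤n) = *-monoˡ-≤-0≤ (≤-trans 0≤1 1≤q) (^ℚ-monoʳ-≤ 1≤q m≤n)

1≤c+1 : ∀ {c} → 0ℚ ≤ c → 1ℚ ≤ c + 1ℚ
1≤c+1 = +-monoˡ-≤ 1ℚ

sumℚ-map-≤ : ∀ {A : Set} (f : A → ℚ) {b xs} →
  All (λ a → f a ≤ b) xs → sumℚ (map f xs) ≤ ℕ→ℚ (length xs) * b
sumℚ-map-≤ f {b} []                      = ≤-reflexive (sym (*-zeroˡ b))
sumℚ-map-≤ f {b} {a ∷ xs} (fa≤b ∷ fxs≤b) = begin
  f a + sumℚ (map f xs)         ≤⟨ +-mono-≤ fa≤b (sumℚ-map-≤ f fxs≤b) ⟩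
  b + ℕ→ℚ (length xs) * b       ≡⟨ ℕ→ℚ-suc-* (length xs) b ⟨
  ℕ→ℚ (suc (length xs)) * b     ∎
  where open ≤-Reasoning

1+c*Σy^e≤y^k : ∀ {A : Set} {c m k} (e : A → ℕ) {xs : List A} → 1ℚ ≤ c →
  All (λ a → e a ℕ.< k) xs → length xs ℕ.≤ m →
  let y = c * ℕ→ℚ (suc m) in 1ℚ + c * sumℚ (map (λ a → y ^ℚ e a) xs) ≤ y ^ℚ k
1+c*Σy^e≤y^k {c = c} {k = zero} e {[]} _ [] _ = ≤-reflexive (1+*0≡1 c)
1+c*Σy^e≤y^k {c = c} {m} {suc k} e {xs} 1≤c e<k |xs|≤m = begin
  1ℚ + c * sumℚ (map (λ a → y ^ℚ e a) xs)
                                          ≤⟨ +-mono-≤ (1≤* 1≤c (1≤^ℚ k 1≤y)) (*-monoˡ-≤-0≤ 0≤c sum≤) ⟩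
  c * Y + c * (ℕ→ℚ m * Y)                 ≡⟨ *-distribˡ-+ c Y (ℕ→ℚ m * Y) ⟨
  c * (Y + ℕ→ℚ m * Y)                     ≡⟨ cong (c *_) (ℕ→ℚ-suc-* m Y) ⟨
  c * (ℕ→ℚ (suc m) * Y)                   ≡⟨ *-assoc c (ℕ→ℚ (suc m)) Y ⟨
  y * Y                                   ∎
  where
  open ≤-Reasoning
  y Y : ℚ
  y = c * ℕ→ℚ (suc m)
  Y = y ^ℚ k
  0≤c : 0ℚ ≤ c
  0≤c = ≤-trans 0≤1 1≤c
  1≤y : 1ℚ ≤ y
  1≤y = 1≤* 1≤c (ℕ→ℚ-mono-≤ {1} {suc m} (s≤s z≤n))
  sum≤ : sumℚ (map (λ a → y ^ℚ e a) xs) ≤ ℕ→ℚ m * Y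
  sum≤ = begin
    sumℚ (map (λ a → y ^ℚ e a) xs)
      ≤⟨ sumℚ-map-≤ _ (All.map (λ ea<k → ^ℚ-monoʳ-≤ 1≤y (s≤s⁻¹ ea<k)) e<k) ⟩
    ℕ→ℚ (length xs) * Y
      ≤⟨ *-monoʳ-≤-0≤ (≤-trans 0≤1 (1≤^ℚ k 1≤y)) (ℕ→ℚ-mono-≤ |xs|≤m) ⟩
    ℕ→ℚ m * Y
      ∎

∈Γ⇒Edge : ∀ {n} {E : Graph n} {v w} → w ∈ Γ E v → Edge E v w
∈Γ⇒Edge {n} {E} {v} w∈Γ = proj₂ (∈-filter⁻ (λ w → T? (E v w)) {xs = allFin n} w∈Γ)

|Γ|<n : ∀ {n} {E : Graph n} {v} → ¬ Edge E v v → length (Γ E v) ℕ.< n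
|Γ|<n {n} {E} {v} ¬loop = subst (length (Γ E v) ℕ.<_) (length-tabulate {n = n} (λ u → u))
  (filter-notAll (λ w → T? (E v w)) (allFin n) (lose (∈-allFin v) ¬loop))

Γ-unique : ∀ {n} (E : Graph n) v → Unique (Γ E v)
Γ-unique {n} E v = Unique-filter⁺ (λ w → T? (E v w)) (allFin⁺ n)

level-<-along-edge : ∀ {n} {E : Graph n} {lvl} → IsLevel E lvl →
  ∀ {v w} → Edge E v w → lvl v ℕ.< lvl w
level-<-along-edge {lvl = lvl} isLevel {v} {w} v→w with proj₂ (isLevel w) (v , v→w)
... | i , lvl-w≡1+i , in-nbrs≤i , _ = subst (lvl v ℕ.<_) (sym lvl-w≡1+i) (s≤s (in-nbrs≤i v v→w))

ρ-admissible : ∀ {n} {E : Graph n} {lvl : Fin n → ℕ} {d c} →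
  (∀ {v w} → Edge E v w → lvl v ℕ.< lvl w) → (∀ v → lvl v ℕ.≤ d) → 1ℚ ≤ c →
  Admissible E c (ρ c lvl d)
ρ-admissible {suc m} {E} {lvl} {d} {c} lvl-< ≤d 1≤c v =
  1+c*Σy^e≤y^k {c = c} {m} (λ w → d ∸ lvl w) 1≤c (All.tabulate exponent-<)
    (s≤s⁻¹ (|Γ|<n {E = E} {v} (λ loop → ℕ.<-irrefl refl (lvl-< loop))))
  where
  exponent-< : ∀ {w} → w ∈ Γ E v → d ∸ lvl w ℕ.< d ∸ lvl v
  exponent-< w∈Γ = ℕ.∸-monoʳ-< (lvl-< (∈Γ⇒Edge {E = E} w∈Γ)) (≤d _)

module _ {A : Set} {P Q : Pred A 0ℓ} (P? : Decidable P) (Q? : Decidable Q) (P⊆Q : P ⊆ Q) where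

  filter-sublist : ∀ xs → filter P? xs Sublist.⊆ filter Q? xs
  filter-sublist xs = filter-sublist⁺ P? Q? (λ { refl → P⊆Q }) (Sublist.⊆-refl {x = xs})

  length-filter-mono-≤ : ∀ xs → length (filter P? xs) ℕ.≤ length (filter Q? xs)
  length-filter-mono-≤ xs = length-mono-≤ (filter-sublist xs)

  length-filter-mono-< : ∀ {z xs} → z ∈ xs → Q z → ¬ P z →
    length (filter P? xs) ℕ.< length (filter Q? xs)
  length-filter-mono-< {z} {xs} z∈xs Qz ¬Pz =
    ℕ.≤∧≢⇒< (length-filter-mono-≤ xs) same-length-absurd
    where
    same-length-absurd : length (filter P? xs) ≢ length (filter Q? xs)
    same-length-absurd eq = ¬Pz (proj₂ (∈-filter⁻ P? {xs = xs}
      (subst (z ∈_) (sym (Pointwise-≡⇒≡ (to-≋ eq (filter-sublist xs)))) (∈-filter⁺ Q? z∈xs Qz))))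

module _ {A : Set} where

  Any-─⁻ : ∀ {P : Pred A 0ℓ} {x xs} (p : x ∈ xs) → Any P (xs ─ p) → Any P xs
  Any-─⁻ (here _)  Pxs─p         = there Pxs─p
  Any-─⁻ (there p) (here Py)     = here Py
  Any-─⁻ (there p) (there Pxs─p) = there (Any-─⁻ p Pxs─p)

  Unique-─⁺ : ∀ {x : A} {xs} (p : x ∈ xs) → Unique xs → Unique (xs ─ p)
  Unique-─⁺ (here _)  (_ ∷ uxs)      = uxs
  Unique-─⁺ (there p) (x≢xs ∷ uxs)   = ─⁺ p x≢xs ∷ Unique-─⁺ p uxs

  ∉-─ : ∀ {x : A} {xs} (p : x ∈ xs) → Unique xs → x ∉ (xs ─ p)
  ∉-─ (here refl) (x≢xs ∷ _)   x∈ = All.lookup x≢xs x∈ refl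
  ∉-─ (there p)   (y≢xs ∷ _)   (here refl) = All.lookup y≢xs p refl
  ∉-─ (there p)   (_ ∷ uxs)    (there x∈) = ∉-─ p uxs x∈

  sumℚ-map-─ : ∀ (f : A → ℚ) {x xs} (p : x ∈ xs) →
    sumℚ (map f xs) ≡ f x + sumℚ (map f (xs ─ p))
  sumℚ-map-─ f (here refl) = refl
  sumℚ-map-─ f {x} {y ∷ xs} (there p) = begin
    f y + sumℚ (map f xs)                   ≡⟨ cong (f y +_) (sumℚ-map-─ f p) ⟩
    f y + (f x + sumℚ (map f (xs ─ p)))     ≡⟨ x∙yz≈y∙xz (f y) (f x) _ ⟩
    f x + (f y + sumℚ (map f (xs ─ p)))     ∎
    where open ≡-Reasoning

1+c*[x^a+s]≤x^M : ∀ {c s a b M} → 0ℚ ≤ c → a ℕ.< M → b ℕ.< M →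
  let x = c + 1ℚ in 1ℚ + c * s ≤ x ^ℚ b → 1ℚ + c * (x ^ℚ a + s) ≤ x ^ℚ M
1+c*[x^a+s]≤x^M {c} {s} {a} {M = suc M} 0≤c (s≤s a≤M) (s≤s b≤M) 1+c*s≤x^b = begin
  1ℚ + c * (x ^ℚ a + s)         ≡⟨ cong (1ℚ +_) (*-distribˡ-+ c (x ^ℚ a) s) ⟩
  1ℚ + (c * x ^ℚ a + c * s)     ≡⟨ x∙yz≈y∙xz 1ℚ (c * x ^ℚ a) (c * s) ⟩
  c * x ^ℚ a + (1ℚ + c * s)     ≤⟨ +-mono-≤ (*-monoˡ-≤-0≤ 0≤c (^ℚ-monoʳ-≤ 1≤x a≤M))
                                            (≤-trans 1+c*s≤x^b (^ℚ-monoʳ-≤ 1≤x b≤M)) ⟩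
  c * X + X                     ≡⟨ cong (c * X +_) (*-identityˡ X) ⟨
  c * X + 1ℚ * X                ≡⟨ *-distribʳ-+ X c 1ℚ ⟨
  x * X                         ∎
  where
  open ≤-Reasoning
  x X : ℚ
  x = c + 1ℚ
  X = x ^ℚ M
  1≤x : 1ℚ ≤ x
  1≤x = 1≤c+1 0≤c

module UpsetCount {n : ℕ} {_≺_ : Rel (Fin n) 0ℓ} (_≺?_ : B.Decidable _≺_)
                  (≺-trans : Transitive _≺_) (≺-irrefl : ∀ {u} → ¬ u ≺ u) where

  #above : Fin n → ℕ
  #above u = length (filter (u ≺?_) (allFin n))

  Upset : List (Fin n) → Pred (Fin n) 0ℓ
  Upset S u = Any (λ w → w ≡ u ⊎ w ≺ u) S

  upset? : ∀ S → Decidable (Upset S)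
  upset? S u = Any.any? (λ w → (w Fin.≟ u) ⊎-dec (w ≺? u)) S

  #upset : List (Fin n) → ℕ
  #upset S = length (filter (upset? S) (allFin n))

  #above-<-#above : ∀ {u w} → u ≺ w → #above w ℕ.< #above u
  #above-<-#above {u} {w} u≺w =
    length-filter-mono-< (w ≺?_) (u ≺?_) (≺-trans u≺w) (∈-allFin w) u≺w ≺-irrefl

  #above<#upset : ∀ {u S} → u ∈ S → #above u ℕ.< #upset S
  #above<#upset {u} {S} u∈S =
    length-filter-mono-< (u ≺?_) (upset? S) (λ u≺w → lose u∈S (inj₂ u≺w))
      (∈-allFin u) (lose u∈S (inj₁ refl)) ≺-irrefl

  #upset-─< : ∀ {m S} (p : m ∈ S) → ¬ Upset (S ─ p) m → #upset (S ─ p) ℕ.< #upset S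
  #upset-─< {m} {S} p m∉↑S─p =
    length-filter-mono-< (upset? (S ─ p)) (upset? S) (Any-─⁻ p)
      (∈-allFin m) (lose p (inj₁ refl)) m∉↑S─p

  ∃-minimal : ∀ {y ys} → Unique (y ∷ ys) →
    Σ (Fin n) λ m → Σ (m ∈ y ∷ ys) λ p → ¬ Upset ((y ∷ ys) ─ p) m
  ∃-minimal {y} {ys} unique = m , m∈ , minimal
    where
    m : Fin n
    m = argmax #above y ys
    m∈ : m ∈ y ∷ ys
    m∈ = argmax-all #above {P = _∈ y ∷ ys} (here refl) (All.tabulate there)
    maximal : All (λ w → #above w ℕ.≤ #above m) (y ∷ ys)
    maximal = f[⊥]≤f[argmax] {f = #above} y ys ∷ f[xs]≤f[argmax] {f = #above} y ys
    minimal : ¬ Upset ((y ∷ ys) ─ m∈) m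
    minimal ↑m with find ↑m
    ... | w , w∈ , inj₁ refl = ∉-─ m∈ unique w∈
    ... | w , w∈ , inj₂ w≺m  = ℕ.<⇒≱ (#above-<-#above w≺m) (All.lookup maximal (Any-─⁻ m∈ w∈))

  upset-bound : ∀ {c} → 0ℚ ≤ c → ∀ S → Unique S →
    1ℚ + c * sumℚ (map (λ w → (c + 1ℚ) ^ℚ #above w) S) ≤ (c + 1ℚ) ^ℚ #upset S
  upset-bound {c} 0≤c S = bound (length S) S refl
    where
    f : Fin n → ℚ
    f w = (c + 1ℚ) ^ℚ #above w
    bound : ∀ k S → length S ≡ k → Unique S →
      1ℚ + c * sumℚ (map f S) ≤ (c + 1ℚ) ^ℚ #upset S
    bound _ [] _ _ = ≤-trans (≤-reflexive (1+*0≡1 c)) (1≤^ℚ (#upset []) (1≤c+1 0≤c))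
    bound (suc k) S@(_ ∷ _) |S|≡1+k unique with ∃-minimal unique
    ... | m , p , m∉↑S─p = begin
      1ℚ + c * sumℚ (map f S)                 ≡⟨ cong (λ t → 1ℚ + c * t) (sumℚ-map-─ f p) ⟩
      1ℚ + c * (f m + sumℚ (map f (S ─ p)))   ≤⟨ 1+c*[x^a+s]≤x^M 0≤c (#above<#upset p) (#upset-─< p m∉↑S─p)
                                                   (bound k (S ─ p) |S─p|≡k (Unique-─⁺ p unique)) ⟩
      (c + 1ℚ) ^ℚ #upset S                    ∎
      where
      open ≤-Reasoning
      |S─p|≡k : length (S ─ p) ≡ k
      |S─p|≡k = ℕ.suc-injective (trans (sym (length-removeAt′ S (Any.index p))) |S|≡1+k)

ω-admissible : ∀ {n} {E : Graph n} → IsDAG E → (reach? : (v w : Fin n) → Dec (Reach E v w)) →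
  ∀ {c} → 0ℚ ≤ c → Admissible E c (ω E reach? c)
ω-admissible {n} {E} dag reach? {c} 0≤c v = begin
  1ℚ + c * sumℚ (map (ω E reach? c) (Γ E v))  ≤⟨ upset-bound 0≤c (Γ E v) (Γ-unique E v) ⟩
  (c + 1ℚ) ^ℚ #upset (Γ E v)                   ≤⟨ ^ℚ-monoʳ-≤ (1≤c+1 0≤c) ↑Γ-smaller ⟩
  ω E reach? c v                               ∎
  where
  open ≤-Reasoning
  open UpsetCount reach? _++_ (λ {u} → dag u)
  ↑Γ⊆Desc : Upset (Γ E v) ⊆ Reach E v
  ↑Γ⊆Desc ↑u with find ↑u
  ... | w , w∈Γ , inj₁ refl = [ ∈Γ⇒Edge {E = E} w∈Γ ]
  ... | w , w∈Γ , inj₂ w⇝u  = ∈Γ⇒Edge {E = E} w∈Γ ∷ w⇝u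
  ↑Γ-smaller : #upset (Γ E v) ℕ.≤ #above v
  ↑Γ-smaller = length-filter-mono-≤ (upset? (Γ E v)) (reach? v) ↑Γ⊆Desc (allFin n)

lemma4p6 : (n : ℕ) (E : Graph n) → IsDAG E →
    (reach? : (v w : Fin n) → Dec (Reach E v w)) →
    (lvl : Fin n → ℕ) → IsLevel E lvl →
    (d : ℕ) → IsDepth lvl d →
    (c : ℚ) → c ≥ 1ℚ + 1ℚ →
    Admissible E c (ρ c lvl d) × Admissible E c (ω E reach? c)
lemma4p6 n E dag reach? lvl isLevel d (≤d , _) c 2≤c =
    ρ-admissible (level-<-along-edge isLevel) ≤d 1≤c
  , ω-admissible dag reach? (≤-trans 0≤1 1≤c)
  where
  1≤c : 1ℚ ≤ c
  1≤c = ≤-trans 1≤2 2≤c
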